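{- Let $r\ge 3$, let $T$ be a tree with $k$ edges and maximum degree $\Delta$, and let $\mathcal{H}$ be a hypergraph with at least one vertex, all of whose hyperedges have size between $2$ and $r$. If every vertex $u$ of $\mathcal{H}$ satisfies $d^N(u)\ge k+(r-3)(k-1)+\Delta-1$, then $\mathcal{H}$ contains a Berge copy of $T$.
   Context: $d^N(u)$ denotes the number of vertices $v\ne u$ such that some hyperedge of $\mathcal{H}$ contains both $u$ and $v$. A hypergraph contains a Berge copy of a graph $T$ if there are distinct hyperedges $f(e)$, $e\in E(T)$, and an injective map $\varphi:V(T)\to V(\mathcal{H})$ such that $\{\varphi(x),\varphi(y)\}\subseteq f(xy)$ for every edge $xy\in E(T)$. -}

module Defs where

open import Data.Nat using (ℕ; zero; suc; _≤_; _+_)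
open import Data.Fin using (Fin; zero; suc; inject₁; fromℕ; _≟_)
open import Data.Fin.Subset using (Subset; _∈_; ∣_∣)
open import Data.Fin.Subset.Properties using (_∈?_)
open import Data.Fin.Properties using (any?)
open import Data.List using (List; length; filter; allFin)
open import Data.Product using (Σ; ∃; _×_; _,_; proj₁; proj₂)
open import Data.Sum using (_⊎_)
open import Relation.Nullary using (¬_; Dec)
open import Relation.Nullary.Decidable using (_×-dec_; _⊎-dec_; ¬?)
open import Relation.Binary.PropositionalEquality using (_≡_)
open import Function.Definitions using (Injective)

count : ∀ {n} {P : Fin n → Set} → (∀ x → Dec (P x)) → ℕ
count {n} P? = length (filter P? (allFin n))

record Graph (t k : ℕ) : Set where
  field
    ends : Fin k → Fin t × Fin t

  end₁ end₂ : Fin k → Fin t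
  end₁ e = proj₁ (ends e)
  end₂ e = proj₂ (ends e)

  Adj : Fin t → Fin t → Set
  Adj x y = ∃ λ e → (end₁ e ≡ x × end₂ e ≡ y) ⊎ (end₁ e ≡ y × end₂ e ≡ x)

  Inc : Fin t → Fin k → Set
  Inc x e = end₁ e ≡ x ⊎ end₂ e ≡ x

  Inc? : ∀ x e → Dec (Inc x e)
  Inc? x e = (end₁ e ≟ x) ⊎-dec (end₂ e ≟ x)

  degree : Fin t → ℕ
  degree x = count (Inc? x)

open Graph public

IsSimple : ∀ {t k} → Graph t k → Set
IsSimple {t} {k} G =
  (∀ e → ¬ (end₁ G e ≡ end₂ G e)) ×
  (∀ e e' → ((end₁ G e ≡ end₁ G e' × end₂ G e ≡ end₂ G e')
             ⊎ (end₁ G e ≡ end₂ G e' × end₂ G e ≡ end₁ G e')) → e ≡ e')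

data Walk {t k} (G : Graph t k) : Fin t → Fin t → Set where
  [] : ∀ {x} → Walk G x x
  _∷_ : ∀ {x y z} → Adj G x y → Walk G y z → Walk G x z

Connected : ∀ {t k} → Graph t k → Set
Connected G = ∀ x y → Walk G x y

-- a cycle: distinct vertices c 0, …, c l (l ≥ 2, i.e. at least 3 vertices),
-- consecutive ones adjacent, and c l adjacent to c 0
record Cycle {t k} (G : Graph t k) : Set where
  field
    l     : ℕ
    l≥2   : 2 ≤ l
    c     : Fin (suc l) → Fin t
    c-inj : Injective _≡_ _≡_ c
    steps : ∀ (i : Fin l) → Adj G (c (inject₁ i)) (c (suc i))
    close : Adj G (c (fromℕ l)) (c zero)

Acyclic : ∀ {t k} → Graph t k → Set
Acyclic G = ¬ Cycle G

IsTree : ∀ {t k} → Graph t k → Set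
IsTree {t} G = (1 ≤ t) × IsSimple G × Connected G × Acyclic G

MaxDegree : ∀ {t k} → Graph t k → ℕ → Set
MaxDegree {t} G Δ = (∀ x → degree G x ≤ Δ) × (∃ λ x → degree G x ≡ Δ)

Hypergraph : ℕ → ℕ → Set
Hypergraph n m = Fin m → Subset n

-- a hypergraph is a set of hyperedges: distinct indices give distinct sets
IsSimpleHypergraph : ∀ {n m} → Hypergraph n m → Set
IsSimpleHypergraph H = Injective _≡_ _≡_ H

Codegree : ∀ {n m} → Hypergraph n m → Fin n → Fin n → Set
Codegree {m = m} H u v = ∃ λ (j : Fin m) → u ∈ H j × v ∈ H j

Neighbour? : ∀ {n m} (H : Hypergraph n m) (u v : Fin n) →
             Dec (¬ (v ≡ u) × Codegree H u v)
Neighbour? H u v = ¬? (v ≟ u) ×-dec any? (λ j → (u ∈? H j) ×-dec (v ∈? H j))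

dN : ∀ {n m} → Hypergraph n m → Fin n → ℕ
dN H u = count (Neighbour? H u)

record BergeCopy {t k n m} (T : Graph t k) (H : Hypergraph n m) : Set where
  field
    φ     : Fin t → Fin n
    φ-inj : Injective _≡_ _≡_ φ
    f     : Fin k → Fin m
    f-inj : Injective _≡_ _≡_ f
    emb   : ∀ e → φ (end₁ T e) ∈ H (f e) × φ (end₂ T e) ∈ H (f e)

-- The copy is grown greedily along T. The embedded vertex set S always spans a subtree; φ is injective
-- on S, the edges inside S go injectively to hyperedges containing the images of their ends, and
-- |φ(S)| ≤ e(S) + 1. Take an edge e = px with p ∈ S, x ∉ S; as T is acyclic it is the only edge from x
-- into S. Send x to a neighbour w of u = φ(p) outside φ(S) that shares with u a hyperedge j not yet
-- used, and send e to j. Such a w exists: otherwise every neighbour of u lies in φ(S) ∖ {u}, of size at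
-- most e(S) ≤ k − 1, or in f(e') ∖ φ(S) for a used edge e' with u ∈ f(e'). Such an f(e') contains the
-- images of the two ends of e', and u as a third vertex unless e' is incident with p, so it contributes
-- at most r − 3 vertices, plus one for each of the at most Δ − 1 used edges at p. Hence
-- d^N(u) ≤ (k − 1)(r − 2) + Δ − 1, contradicting the hypothesis.

module Submission where

open import Data.Fin using (Fin; zero; suc; _≟_; inject₁; fromℕ; fromℕ<)
open import Data.Fin.Properties using (any?; toℕ<n)
open import Data.Fin.Subset using (Subset; _∈_; ∣_∣; inside; outside; ⁅_⁆; _-_)
open import Data.Fin.Subset.Properties
  using (_∈?_; drop-there; x∈⁅x⁆; ∣⁅x⁆∣≡1; x∈p⇒∣p-x∣<∣p∣; x∈p∧x≢y⇒x∈p-y)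
open import Data.List using (List; []; _∷_; filter; length; tabulate; allFin; lookup; _∷ʳ_)
open import Data.List.Properties using (length-filter; length-tabulate)
open import Data.List.Membership.Propositional.Properties using (∈-lookup)
open import Data.List.Relation.Unary.All as All using (All; []; _∷_)
import Data.List.Relation.Unary.All.Properties as All
open import Data.List.Relation.Unary.AllPairs using ([]; _∷_)
open import Data.List.Relation.Unary.Any using (here)
open import Data.List.Relation.Unary.Unique.Propositional using (Unique)
import Data.List.Relation.Unary.Unique.Propositional.Properties as Unique
open import Data.Nat using (ℕ; zero; suc; _≤_; _<_; _+_; _*_; _∸_; z≤n; s≤s)
open import Data.Nat.Induction using (<-wellFounded)
open import Data.Nat.Properties
  using ( ≤-refl; ≤-reflexive; ≤-trans; ≤-antisym; ≤-pred; n<1+n; <⇒≱; m≤n+m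
        ; +-comm; +-cancelˡ-≤; +-mono-≤; +-monoˡ-≤; +-monoʳ-≤; +-mono-≤-<; *-monoˡ-≤
        ; module ≤-Reasoning; +-*-semiring )
open import Data.Nat.Tactic.RingSolver using (solve-∀)
open import Algebra.Properties.Semiring.Sum +-*-semiring using (sum; ∑-distrib-+; *-distribʳ-sum)
open import Data.Product as Product using (∃; ∃₂; _×_; _,_; proj₁; proj₂; map₂)
open import Data.Sum as Sum using (_⊎_; inj₁; inj₂; [_,_]; [_,_]′; swap)
open import Data.Unit using (tt)
open import Data.Vec using ([]; _∷_; there)
open import Data.Vec.Functional using (Vector; updateAt)
open import Data.Vec.Functional.Properties using (updateAt-updates; updateAt-minimal)
open import Function using (_∘_; id; const; case_of_)
open import Function.Definitions using (Injective)
open import Induction.WellFounded using (Acc; acc)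
open import Level using (0ℓ)
open import Relation.Binary.PropositionalEquality
  using (_≡_; _≢_; refl; sym; trans; cong; cong₂; subst; subst₂)
open import Relation.Nullary using (¬_; Dec; yes; no; contradiction)
open import Relation.Nullary.Decidable using (_×-dec_; ¬?; decidable-stable)
open import Relation.Unary using (Pred; Decidable; _⊆_; _∪_; ∅; ｛_｝)
open import Relation.Unary.Properties using (_∪?_; ∅?; ∁?)

open import Defs

private
  variable
    n : ℕ

indicator : ∀ {p} {A : Set p} → Dec A → ℕ
indicator (yes _) = 1
indicator (no _)  = 0

indicator-mono : ∀ {p q} {A : Set p} {B : Set q} (a : Dec A) (b : Dec B) →
                 (A → B) → indicator a ≤ indicator b
indicator-mono (yes _) (yes _) _   = ≤-refl
indicator-mono (yes a) (no ¬b) A→B = contradiction (A→B a) ¬b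
indicator-mono (no _)  _       _   = z≤n

indicator-⊎ : ∀ {p q r} {A : Set p} {B : Set q} {C : Set r} (a : Dec A) (b : Dec B) (c : Dec C) →
              (A → B ⊎ C) → indicator a ≤ indicator b + indicator c
indicator-⊎ (no _)  _       _       _     = z≤n
indicator-⊎ (yes _) (yes _) _       _     = s≤s z≤n
indicator-⊎ (yes _) (no _)  (yes _) _     = ≤-refl
indicator-⊎ (yes a) (no ¬b) (no ¬c) A→B⊎C = contradiction (A→B⊎C a) [ ¬b , ¬c ]

∑-mono-≤ : {f g : Vector ℕ n} → (∀ i → f i ≤ g i) → sum f ≤ sum g
∑-mono-≤ {n = zero}  f≤g = z≤n
∑-mono-≤ {n = suc n} f≤g = +-mono-≤ (f≤g zero) (∑-mono-≤ (f≤g ∘ suc))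

length-filter-tabulate : ∀ {a} {A : Set a} {P : Pred A 0ℓ} (P? : Decidable P) (g : Fin n → A) →
                         length (filter P? (tabulate g)) ≡ count (P? ∘ g)
length-filter-tabulate {n = zero}  P? g = refl
length-filter-tabulate {n = suc n} P? g with P? (g zero)
... | yes _ = cong suc (trans (length-filter-tabulate P? (g ∘ suc)) (sym (length-filter-tabulate (P? ∘ g) suc)))
... | no _  = trans (length-filter-tabulate P? (g ∘ suc)) (sym (length-filter-tabulate (P? ∘ g) suc))

count-suc : {P : Pred (Fin (suc n)) 0ℓ} (P? : Decidable P) →
            count P? ≡ indicator (P? zero) + count (P? ∘ suc)
count-suc P? with P? zero
... | yes _ = cong suc (length-filter-tabulate P? suc)
... | no _  = length-filter-tabulate P? suc

∑-indicator : {P : Pred (Fin n) 0ℓ} (P? : Decidable P) → sum (indicator ∘ P?) ≡ count P?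
∑-indicator {n = zero}  P? = refl
∑-indicator {n = suc n} P? =
  trans (cong (indicator (P? zero) +_) (∑-indicator (P? ∘ suc))) (sym (count-suc P?))

count-mono : {P Q : Pred (Fin n) 0ℓ} (P? : Decidable P) (Q? : Decidable Q) → P ⊆ Q → count P? ≤ count Q?
count-mono P? Q? P⊆Q =
  subst₂ _≤_ (∑-indicator P?) (∑-indicator Q?) (∑-mono-≤ (λ i → indicator-mono (P? i) (Q? i) P⊆Q))

count-cong : {P Q : Pred (Fin n) 0ℓ} (P? : Decidable P) (Q? : Decidable Q) →
             P ⊆ Q → Q ⊆ P → count P? ≡ count Q?
count-cong P? Q? P⊆Q Q⊆P = ≤-antisym (count-mono P? Q? P⊆Q) (count-mono Q? P? Q⊆P)

count-⊆∪ : {P Q R : Pred (Fin n) 0ℓ} (P? : Decidable P) (Q? : Decidable Q) (R? : Decidable R) →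
           R ⊆ P ∪ Q → count R? ≤ count P? + count Q?
count-⊆∪ P? Q? R? R⊆P∪Q = begin
  count R?                                         ≡⟨ ∑-indicator R? ⟨
  sum (indicator ∘ R?)                             ≤⟨ ∑-mono-≤ (λ i → indicator-⊎ (R? i) (P? i) (Q? i) R⊆P∪Q) ⟩
  sum (λ i → indicator (P? i) + indicator (Q? i))  ≡⟨ ∑-distrib-+ (indicator ∘ P?) (indicator ∘ Q?) ⟩
  sum (indicator ∘ P?) + sum (indicator ∘ Q?)      ≡⟨ cong₂ _+_ (∑-indicator P?) (∑-indicator Q?) ⟩
  count P? + count Q?                              ∎
  where open ≤-Reasoning

count-none : {P : Pred (Fin n) 0ℓ} (P? : Decidable P) → (∀ x → ¬ P x) → count P? ≡ 0
count-none {n = zero}  P? ¬P = refl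
count-none {n = suc n} P? ¬P rewrite count-suc P? with P? zero
... | yes Pz = contradiction Pz (¬P zero)
... | no _   = count-none (P? ∘ suc) (¬P ∘ suc)

count-⋃ : ∀ {k} {R : Pred (Fin n) 0ℓ} {P : Fin k → Pred (Fin n) 0ℓ} →
          (R? : Decidable R) (P? : ∀ e → Decidable (P e)) →
          (∀ {w} → R w → ∃ λ e → P e w) → count R? ≤ sum (λ e → count (P? e))
count-⋃ {k = zero}  R? P? R⊆⋃P = ≤-reflexive (count-none R? (λ _ r → case R⊆⋃P r of λ ()))
count-⋃ {k = suc k} {R = R} {P = P} R? P? R⊆⋃P =
  ≤-trans (count-⊆∪ (P? zero) ⋃P? R? split)
          (+-monoʳ-≤ (count (P? zero)) (count-⋃ ⋃P? (P? ∘ suc) id))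
  where
  ⋃P? : Decidable (λ w → ∃ λ e → P (suc e) w)
  ⋃P? w = any? (λ e → P? (suc e) w)
  split : R ⊆ P zero ∪ (λ w → ∃ λ e → P (suc e) w)
  split r with R⊆⋃P r
  ... | zero  , p = inj₁ p
  ... | suc e , p = inj₂ (e , p)

count-< : {P Q : Pred (Fin n) 0ℓ} (P? : Decidable P) (Q? : Decidable Q) {c : Fin n} →
          P c → ¬ Q c → Q ⊆ P → count Q? < count P?
count-< P? Q? {zero} Pc ¬Qc Q⊆P rewrite count-suc P? | count-suc Q? with P? zero | Q? zero
... | no ¬Pc | _      = contradiction Pc ¬Pc
... | _      | yes Qc = contradiction Qc ¬Qc
... | yes _  | no _   = s≤s (count-mono (Q? ∘ suc) (P? ∘ suc) Q⊆P)
count-< P? Q? {suc c} Pc ¬Qc Q⊆P rewrite count-suc P? | count-suc Q? =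
  +-mono-≤-< (indicator-mono (Q? zero) (P? zero) Q⊆P) (count-< (P? ∘ suc) (Q? ∘ suc) Pc ¬Qc Q⊆P)

∃⇒count>0 : {P : Pred (Fin n) 0ℓ} (P? : Decidable P) {c : Fin n} → P c → 0 < count P?
∃⇒count>0 P? Pc = ≤-trans (s≤s z≤n) (count-< P? ∅? Pc (λ ()) (λ ()))

count-∁-insert : {P : Pred (Fin n) 0ℓ} (P? : Decidable P) {x : Fin n} →
                 ¬ P x → count (∁? (P? ∪? (x ≟_))) < count (∁? P?)
count-∁-insert P? x∉P =
  count-< (∁? P?) (∁? (P? ∪? (_ ≟_))) x∉P (λ x∉P' → x∉P' (inj₂ refl)) (λ y∉P' Py → y∉P' (inj₁ Py))

count≤n : {P : Pred (Fin n) 0ℓ} (P? : Decidable P) → count P? ≤ n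
count≤n {n = n} P? = ≤-trans (length-filter P? (allFin n)) (≤-reflexive (length-tabulate id))

count<n : {P : Pred (Fin n) 0ℓ} (P? : Decidable P) {c : Fin n} → ¬ P c → count P? < n
count<n P? {zero} ¬Pc rewrite count-suc P? with P? zero
... | yes Pc = contradiction Pc ¬Pc
... | no _   = s≤s (count≤n (P? ∘ suc))
count<n P? {suc c} ¬Pc rewrite count-suc P? =
  +-mono-≤-< (indicator-mono (P? zero) (yes tt) (λ _ → tt)) (count<n (P? ∘ suc) ¬Pc)

count>0⇒∃ : {P : Pred (Fin n) 0ℓ} (P? : Decidable P) → 0 < count P? → ∃ P
count>0⇒∃ {n = suc n} P? count>0 with P? zero | count-suc P?
... | yes Pz | _  = zero , Pz
... | no _   | eq = let x , Px = count>0⇒∃ (P? ∘ suc) (subst (0 <_) eq count>0) in suc x , Px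

count-∈ : (s : Subset n) → count (_∈? s) ≡ ∣ s ∣
count-∈ []            = refl
count-∈ (inside ∷ s)  =
  trans (count-suc (_∈? (inside ∷ s))) (cong suc (trans (count-cong _ (_∈? s) drop-there there) (count-∈ s)))
count-∈ (outside ∷ s) =
  trans (count-suc (_∈? (outside ∷ s))) (trans (count-cong _ (_∈? s) drop-there there) (count-∈ s))

count≤∣s∣ : {P : Pred (Fin n) 0ℓ} (P? : Decidable P) (s : Subset n) →
            P ⊆ (_∈ s) → count P? ≤ ∣ s ∣
count≤∣s∣ P? s P⊆s = ≤-trans (count-mono P? (_∈? s) P⊆s) (≤-reflexive (count-∈ s))

count≤1 : {P : Pred (Fin n) 0ℓ} (P? : Decidable P) {c : Fin n} → P ⊆ ｛ c ｝ → count P? ≤ 1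
count≤1 P? {c} P⊆c =
  ≤-trans (count≤∣s∣ P? ⁅ c ⁆ (λ Px → subst (_∈ ⁅ c ⁆) (P⊆c Px) (x∈⁅x⁆ c)))
          (≤-reflexive (∣⁅x⁆∣≡1 c))

∣p-x-y∣+2≤∣p∣ : ∀ {p : Subset n} {x y} → x ∈ p → y ∈ p → y ≢ x →
                2 + ∣ p - x - y ∣ ≤ ∣ p ∣
∣p-x-y∣+2≤∣p∣ x∈p y∈p y≢x =
  ≤-trans (s≤s (x∈p⇒∣p-x∣<∣p∣ (x∈p∧x≢y⇒x∈p-y y∈p y≢x))) (x∈p⇒∣p-x∣<∣p∣ x∈p)

∣p-x-y-z∣+3≤∣p∣ : ∀ {p : Subset n} {x y z} →
                  x ∈ p → y ∈ p → z ∈ p → y ≢ x → z ≢ x → z ≢ y →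
                  3 + ∣ p - x - y - z ∣ ≤ ∣ p ∣
∣p-x-y-z∣+3≤∣p∣ x∈p y∈p z∈p y≢x z≢x z≢y =
  ≤-trans (s≤s (s≤s (x∈p⇒∣p-x∣<∣p∣ (x∈p∧x≢y⇒x∈p-y (x∈p∧x≢y⇒x∈p-y z∈p z≢x) z≢y))))
          (∣p-x-y∣+2≤∣p∣ x∈p y∈p y≢x)

greedy-bound : ∀ R {I J k Δ} → I < k → J < Δ → I + (I * R + J) < (k + R * (k ∸ 1) + Δ) ∸ 1
greedy-bound R {I} {J} {suc k} {suc Δ} (s≤s I≤k) (s≤s J≤Δ) = begin-strict
  I + (I * R + J)        ≤⟨ +-mono-≤ I≤k (+-mono-≤ (*-monoˡ-≤ R I≤k) J≤Δ) ⟩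
  k + (k * R + Δ)        <⟨ n<1+n _ ⟩
  suc (k + (k * R + Δ))  ≡⟨ rearrange k R Δ ⟩
  k + R * k + suc Δ      ∎
  where
  open ≤-Reasoning
  rearrange : ∀ k R Δ → suc (k + (k * R + Δ)) ≡ k + R * k + suc Δ
  rearrange = solve-∀

lookup-injective : ∀ {a} {A : Set a} {xs : List A} → Unique xs → Injective _≡_ _≡_ (lookup xs)
lookup-injective (_    ∷ _) {zero}  {zero}  _  = refl
lookup-injective (x≢xs ∷ _) {zero}  {suc j} eq = contradiction eq (All.lookup x≢xs (∈-lookup j))
lookup-injective (x≢xs ∷ _) {suc i} {zero}  eq = contradiction (sym eq) (All.lookup x≢xs (∈-lookup i))
lookup-injective (_    ∷ u) {suc i} {suc j} eq = cong suc (lookup-injective u eq)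

module _ {t k} (G : Graph t k) where

  Joins : Fin k → Fin t → Fin t → Set
  Joins e x y = (end₁ G e ≡ x × end₂ G e ≡ y) ⊎ (end₁ G e ≡ y × end₂ G e ≡ x)

  Inside : Pred (Fin t) 0ℓ → Pred (Fin k) 0ℓ
  Inside S e = S (end₁ G e) × S (end₂ G e)

  inside? : ∀ {S} → Decidable S → Decidable (Inside S)
  inside? S? e = S? (end₁ G e) ×-dec S? (end₂ G e)

  joins⇒inc : ∀ {e x y} → Joins e x y → Inc G x e
  joins⇒inc = Sum.map proj₁ proj₂

  joins⇒¬inside : ∀ {S e x y} → ¬ S y → Joins e x y → ¬ Inside S e
  joins⇒¬inside y∉S (inj₁ (_ , e₂≡y)) (_ , S₂) = y∉S (subst _ e₂≡y S₂)
  joins⇒¬inside y∉S (inj₂ (e₁≡y , _)) (S₁ , _) = y∉S (subst _ e₁≡y S₁)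

  Chain : Fin t → List (Fin t) → Fin t → Set
  Chain y []       z = y ≡ z
  Chain y (v ∷ vs) z = Adj G y v × Chain v vs z

  record PathIn (S : Pred (Fin t) 0ℓ) (y z : Fin t) : Set where
    field
      inner  : List (Fin t)
      chain  : Chain y inner z
      unique : Unique (y ∷ inner)
      within : All S (y ∷ inner)

  ConnectedIn : Pred (Fin t) 0ℓ → Set
  ConnectedIn S = ∀ {y z} → S y → S z → PathIn S y z

  adj-sym : ∀ {x y} → Adj G x y → Adj G y x
  adj-sym = map₂ swap

  chain-snoc : ∀ {y vs z x} → Chain y vs z → Adj G z x → Chain y (vs ∷ʳ x) x
  chain-snoc {vs = []}    refl         z~x = z~x , refl
  chain-snoc {vs = _ ∷ _} (y~v , rest) z~x = y~v , chain-snoc rest z~x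

  chain-step : ∀ {y vs z} → Chain y vs z → (i : Fin (length vs)) →
               Adj G (lookup (y ∷ vs) (inject₁ i)) (lookup (y ∷ vs) (suc i))
  chain-step {vs = _ ∷ _} (y~v , _)    zero    = y~v
  chain-step {vs = _ ∷ _} (_   , rest) (suc i) = chain-step rest i

  chain-last : ∀ {y vs z} → Chain y vs z → lookup (y ∷ vs) (fromℕ (length vs)) ≡ z
  chain-last {vs = []}    y≡z       = y≡z
  chain-last {vs = _ ∷ _} (_ , rest) = chain-last rest

  module _ {S : Pred (Fin t) 0ℓ} {x : Fin t} (x∉S : ¬ S x) where

    ≢-outside : ∀ {vs} → All S vs → All (x ≢_) vs
    ≢-outside = All.map (λ Sv x≡v → x∉S (subst S (sym x≡v) Sv))

    path-trivial : PathIn (S ∪ ｛ x ｝) x x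
    path-trivial = record { inner = [] ; chain = refl ; unique = [] ∷ [] ; within = inj₂ refl ∷ [] }

    path-weaken : ∀ {y z} → PathIn S y z → PathIn (S ∪ ｛ x ｝) y z
    path-weaken π = record { inner = inner ; chain = chain ; unique = unique ; within = All.map inj₁ within }
      where open PathIn π

    path-cons : ∀ {y z} → Adj G x y → PathIn S y z → PathIn (S ∪ ｛ x ｝) x z
    path-cons x~y π = record
      { inner  = _ ∷ inner
      ; chain  = x~y , chain
      ; unique = ≢-outside within ∷ unique
      ; within = inj₂ refl ∷ All.map inj₁ within
      }
      where open PathIn π

    path-snoc : ∀ {y z} → PathIn S y z → Adj G z x → PathIn (S ∪ ｛ x ｝) y x
    path-snoc π z~x = record
      { inner  = inner ∷ʳ x
      ; chain  = chain-snoc chain z~x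
      ; unique = Unique.++⁺ unique ([] ∷ []) λ { (v∈ , here refl) → All.lookup (≢-outside within) v∈ refl }
      ; within = All.∷ʳ⁺ (All.map inj₁ within) (inj₂ refl)
      }
      where open PathIn π

    connected-insert : ConnectedIn S → ∀ {p} → S p → Adj G p x → ConnectedIn (S ∪ ｛ x ｝)
    connected-insert conn Sp p~x (inj₁ Sy)   (inj₁ Sz)   = path-weaken (conn Sy Sz)
    connected-insert conn Sp p~x (inj₁ Sy)   (inj₂ refl) = path-snoc (conn Sy Sp) p~x
    connected-insert conn Sp p~x (inj₂ refl) (inj₁ Sz)   = path-cons (adj-sym p~x) (conn Sp Sz)
    connected-insert conn Sp p~x (inj₂ refl) (inj₂ refl) = path-trivial

    close-cycle : ∀ {p q} → Adj G x q → PathIn S q p → q ≢ p → Adj G p x → Cycle G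
    close-cycle x~q record { inner = [] ; chain = q≡p } q≢p p~x = contradiction q≡p q≢p
    close-cycle x~q record { inner = v ∷ vs ; chain = chain ; unique = unique ; within = within } q≢p p~x =
      record
      { l     = length (x ∷ v ∷ vs)
      ; l≥2   = s≤s (s≤s z≤n)
      ; c     = lookup (x ∷ _ ∷ v ∷ vs)
      ; c-inj = lookup-injective (≢-outside within ∷ unique)
      ; steps = chain-step {vs = _ ∷ v ∷ vs} (x~q , chain)
      ; close = subst (λ y → Adj G y x) (sym (chain-last {vs = _ ∷ v ∷ vs} (x~q , chain))) p~x
      }

  simple-joins : IsSimple G → ∀ {e e' x y} → Joins e x y → Joins e' x y → e ≡ e'
  simple-joins (_ , same) (inj₁ (a₁ , a₂)) (inj₁ (b₁ , b₂)) = same _ _ (inj₁ (trans a₁ (sym b₁) , trans a₂ (sym b₂)))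
  simple-joins (_ , same) (inj₁ (a₁ , a₂)) (inj₂ (b₁ , b₂)) = same _ _ (inj₂ (trans a₁ (sym b₂) , trans a₂ (sym b₁)))
  simple-joins (_ , same) (inj₂ (a₁ , a₂)) (inj₁ (b₁ , b₂)) = same _ _ (inj₂ (trans a₁ (sym b₂) , trans a₂ (sym b₁)))
  simple-joins (_ , same) (inj₂ (a₁ , a₂)) (inj₂ (b₁ , b₂)) = same _ _ (inj₁ (trans a₁ (sym b₁) , trans a₂ (sym b₂)))

  module _ (simple : IsSimple G) (acyclic : Acyclic G) {S : Pred (Fin t) 0ℓ} (conn : ConnectedIn S)
           {p x e} (Sp : S p) (x∉S : ¬ S x) (e-joins : Joins e p x) where

    unique-edge-into : ∀ {q e'} → S q → Joins e' x q → e' ≡ e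
    unique-edge-into {q} Sq e'-joins with q ≟ p
    ... | yes refl = simple-joins simple e'-joins (swap e-joins)
    ... | no q≢p   = contradiction (close-cycle x∉S (_ , e'-joins) (conn Sq Sp) q≢p (e , e-joins)) acyclic

    inside-insert⁻ : ∀ {e'} → Inside (S ∪ ｛ x ｝) e' → Inside S e' ⊎ e' ≡ e
    inside-insert⁻      (inj₁ S₁  , inj₁ S₂)  = inj₁ (S₁ , S₂)
    inside-insert⁻ {e'} (inj₂ x≡₁ , inj₂ x≡₂) = contradiction (trans (sym x≡₁) x≡₂) (proj₁ simple e')
    inside-insert⁻      (inj₁ S₁  , inj₂ x≡₂) = inj₂ (unique-edge-into S₁ (inj₂ (refl , sym x≡₂)))
    inside-insert⁻      (inj₂ x≡₁ , inj₁ S₂)  = inj₂ (unique-edge-into S₂ (inj₁ (sym x≡₁ , refl)))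

  crossing-edge : ∀ {S : Pred (Fin t) 0ℓ} → Decidable S → ∀ {a b} → Walk G a b → S a → ¬ S b →
                  ∃₂ λ p x → S p × ¬ S x × Adj G p x
  crossing-edge S? []                    Sa b∉S = contradiction Sa b∉S
  crossing-edge S? (_∷_ {y = y} a~y walk) Sa b∉S with S? y
  ... | yes Sy  = crossing-edge S? walk Sy b∉S
  ... | no y∉S  = _ , y , Sa , y∉S , a~y

Image : ∀ {t} → Pred (Fin t) 0ℓ → (Fin t → Fin n) → Pred (Fin n) 0ℓ
Image S φ w = ∃ λ y → S y × φ y ≡ w

image? : ∀ {t} {S : Pred (Fin t) 0ℓ} → Decidable S → (φ : Fin t → Fin n) → Decidable (Image S φ)
image? S? φ w = any? λ y → S? y ×-dec (φ y ≟ w)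

module _ {t k n m} (T : Graph t k) (H : Hypergraph n m) where

  record BergeCopyOn (S : Pred (Fin t) 0ℓ) : Set where
    field
      φ     : Fin t → Fin n
      f     : Fin k → Fin m
      φ-inj : ∀ {x y} → S x → S y → φ x ≡ φ y → x ≡ y
      f-inj : ∀ {e e'} → Inside T S e → Inside T S e' → f e ≡ f e' → e ≡ e'
      emb   : ∀ {e} → Inside T S e → φ (end₁ T e) ∈ H (f e) × φ (end₂ T e) ∈ H (f e)

  record SubtreeCopy {S : Pred (Fin t) 0ℓ} (S? : Decidable S) : Set where
    field
      root        : Fin t
      root∈S      : S root
      connectedIn : ConnectedIn T S
      copy        : BergeCopyOn S
    open BergeCopyOn copy public
    field
      image-bound : count (image? S? φ) ≤ count (inside? T S?) + 1

  complete : ∀ {S : Pred (Fin t) 0ℓ} {S? : Decidable S} → SubtreeCopy S? → (∀ y → S y) → BergeCopy T H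
  complete sc all = record
    { φ     = φ
    ; φ-inj = φ-inj (all _) (all _)
    ; f     = f
    ; f-inj = f-inj (all _ , all _) (all _ , all _)
    ; emb   = λ _ → emb (all _ , all _)
    }
    where open SubtreeCopy sc

  initial : IsSimple T → ∀ r → Fin n → (Fin k → Fin m) → SubtreeCopy (∅? ∪? (r ≟_))
  initial simple r v f₀ = record
    { root        = r
    ; root∈S      = inj₂ refl
    ; connectedIn = λ { (inj₂ refl) (inj₂ refl) → path-trivial T (λ ()) }
    ; copy        = record
      { φ     = const v
      ; f     = f₀
      ; φ-inj = λ { (inj₂ refl) (inj₂ refl) _ → refl }
      ; f-inj = λ e∈S → contradiction e∈S no-inside-edge
      ; emb   = λ e∈S → contradiction e∈S no-inside-edge
      }
    ; image-bound = ≤-trans (count≤1 (image? (∅? ∪? (r ≟_)) (const v)) (λ (_ , _ , v≡w) → v≡w)) (m≤n+m 1 _)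
    }
    where
    no-inside-edge : ∀ {e} → ¬ Inside T (∅ ∪ ｛ r ｝) e
    no-inside-edge {e} (inj₂ r≡e₁ , inj₂ r≡e₂) = proj₁ simple e (trans (sym r≡e₁) r≡e₂)

  module _ {S : Pred (Fin t) 0ℓ} {S? : Decidable S} (sc : SubtreeCopy S?) where
    open SubtreeCopy sc

    Covered : Fin n → Pred (Fin n) 0ℓ
    Covered u w = ∃ λ e → Inside T S e × u ∈ H (f e) × w ∈ H (f e)

    Fresh : Fin n → Pred (Fin n) 0ℓ
    Fresh u w = (¬ w ≡ u × Codegree H u w) × ¬ Image S φ w × ¬ Covered u w

    covered? : ∀ u → Decidable (Covered u)
    covered? u w = any? λ e → inside? T S? e ×-dec (u ∈? H (f e) ×-dec w ∈? H (f e))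

    fresh? : ∀ u → Decidable (Fresh u)
    fresh? u w = Neighbour? H u w ×-dec (¬? (image? S? φ w) ×-dec ¬? (covered? u w))

    SpareIn : Fin k → Fin n → Pred (Fin n) 0ℓ
    SpareIn e u w = Inside T S e × u ∈ H (f e) × w ∈ H (f e) × ¬ Image S φ w

    spare? : ∀ e u → Decidable (SpareIn e u)
    spare? e u w = inside? T S? e ×-dec (u ∈? H (f e) ×-dec (w ∈? H (f e) ×-dec ¬? (image? S? φ w)))

    ∉image : ∀ {w y} → ¬ Image S φ w → S y → w ≢ φ y
    ∉image w∉φS Sy w≡φy = w∉φS (_ , Sy , sym w≡φy)

    module _ {p : Fin t} (Sp : S p) where

      image∖u? : Decidable (λ w → Image S φ w × w ≢ φ p)
      image∖u? w = image? S? φ w ×-dec ¬? (w ≟ φ p)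

      count-image∖u : count image∖u? ≤ count (inside? T S?)
      count-image∖u = ≤-pred (begin-strict
        count image∖u?             <⟨ count-< (image? S? φ) image∖u? (p , Sp , refl) (λ (_ , u≢u) → u≢u refl) proj₁ ⟩
        count (image? S? φ)        ≤⟨ image-bound ⟩
        count (inside? T S?) + 1   ≡⟨ +-comm _ 1 ⟩
        suc (count (inside? T S?)) ∎)
        where open ≤-Reasoning

      dN-without-fresh : ¬ ∃ (Fresh (φ p)) → dN H (φ p) ≤ count image∖u? + sum (λ e → count (spare? e (φ p)))
      dN-without-fresh none =
        ≤-trans (count-⊆∪ image∖u? spare-somewhere? (Neighbour? H (φ p)) stale)
                (+-monoʳ-≤ (count image∖u?) (count-⋃ spare-somewhere? (λ e → spare? e (φ p)) id))
        where
        spare-somewhere? : Decidable (λ w → ∃ λ e → SpareIn e (φ p) w)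
        spare-somewhere? w = any? λ e → spare? e (φ p) w
        stale : ∀ {w} → ¬ w ≡ φ p × Codegree H (φ p) w → (Image S φ w × w ≢ φ p) ⊎ ∃ λ e → SpareIn e (φ p) w
        stale {w} nb with image? S? φ w | covered? (φ p) w
        ... | yes w∈φS | _                           = inj₁ (w∈φS , proj₁ nb)
        ... | no w∉φS  | yes (e , e∈S , u∈fe , w∈fe) = inj₂ (e , e∈S , u∈fe , w∈fe , w∉φS)
        ... | no w∉φS  | no uncovered                = contradiction (w , nb , w∉φS , uncovered) none

      incident? : Decidable (λ e → Inside T S e × Inc T p e)
      incident? e = inside? T S? e ×-dec Inc? T p e

      spare-⊆ : ∀ {e} → Inside T S e → SpareIn e (φ p) ⊆ (_∈ H (f e) - φ (end₁ T e) - φ (end₂ T e))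
      spare-⊆ (S₁ , S₂) (_ , _ , w∈fe , w∉φS) =
        x∈p∧x≢y⇒x∈p-y (x∈p∧x≢y⇒x∈p-y w∈fe (∉image w∉φS S₁)) (∉image w∉φS S₂)

      spare-⊆ᵘ : ∀ {e} → Inside T S e → SpareIn e (φ p) ⊆ (_∈ H (f e) - φ (end₁ T e) - φ (end₂ T e) - φ p)
      spare-⊆ᵘ e∈S sp@(_ , _ , _ , w∉φS) = x∈p∧x≢y⇒x∈p-y (spare-⊆ e∈S sp) (∉image w∉φS Sp)

      module _ (simple : IsSimple T) {R} (∣H∣≤ : ∀ j → ∣ H j ∣ ≤ 3 + R) where

        ends-distinct : ∀ {e} → Inside T S e → φ (end₂ T e) ≢ φ (end₁ T e)
        ends-distinct {e} (S₁ , S₂) eq = proj₁ simple e (sym (φ-inj S₂ S₁ eq))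

        count-spare-incident : ∀ {e} → Inside T S e → count (spare? e (φ p)) ≤ suc R
        count-spare-incident {e} e∈S =
          ≤-trans (count≤∣s∣ _ _ (spare-⊆ e∈S)) (+-cancelˡ-≤ 2 _ _ (≤-trans two-fewer (∣H∣≤ (f e))))
          where
          two-fewer = ∣p-x-y∣+2≤∣p∣ (proj₁ (emb e∈S)) (proj₂ (emb e∈S)) (ends-distinct e∈S)

        count-spare-¬incident : ∀ {e} → Inside T S e → ¬ Inc T p e → count (spare? e (φ p)) ≤ R
        count-spare-¬incident {e} e∈S@(S₁ , S₂) ¬inc = bound (φ p ∈? H (f e))
          where
          u≢φ₁ : φ p ≢ φ (end₁ T e)
          u≢φ₁ eq = ¬inc (inj₁ (φ-inj S₁ Sp (sym eq)))
          u≢φ₂ : φ p ≢ φ (end₂ T e)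
          u≢φ₂ eq = ¬inc (inj₂ (φ-inj S₂ Sp (sym eq)))
          bound : Dec (φ p ∈ H (f e)) → count (spare? e (φ p)) ≤ R
          bound (no u∉fe)  = ≤-trans (≤-reflexive (count-none (spare? e (φ p)) (λ _ → u∉fe ∘ proj₁ ∘ proj₂))) z≤n
          bound (yes u∈fe) =
            ≤-trans (count≤∣s∣ _ _ (spare-⊆ᵘ e∈S)) (+-cancelˡ-≤ 3 _ _ (≤-trans three-fewer (∣H∣≤ (f e))))
            where
            three-fewer = ∣p-x-y-z∣+3≤∣p∣ (proj₁ (emb e∈S)) (proj₂ (emb e∈S)) u∈fe (ends-distinct e∈S) u≢φ₁ u≢φ₂

        count-spare : ∀ e → count (spare? e (φ p)) ≤ indicator (inside? T S? e) * R + indicator (incident? e)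
        count-spare e = bound (inside? T S? e) (Inc? T p e)
          where
          suc≡1*+1 : ∀ R → suc R ≡ 1 * R + 1
          suc≡1*+1 = solve-∀
          ≡1*+0 : ∀ R → R ≡ 1 * R + 0
          ≡1*+0 = solve-∀
          bound : (e∈S? : Dec (Inside T S e)) (inc? : Dec (Inc T p e)) →
                  count (spare? e (φ p)) ≤ indicator e∈S? * R + indicator (e∈S? ×-dec inc?)
          bound (no e∉S)  _         = ≤-reflexive (count-none (spare? e (φ p)) (λ _ → e∉S ∘ proj₁))
          bound (yes e∈S) (yes inc) = ≤-trans (count-spare-incident e∈S) (≤-reflexive (suc≡1*+1 R))
          bound (yes e∈S) (no ¬inc) = ≤-trans (count-spare-¬incident e∈S ¬inc) (≤-reflexive (≡1*+0 R))

        ∑-count-spare : sum (λ e → count (spare? e (φ p))) ≤ count (inside? T S?) * R + count incident?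
        ∑-count-spare = begin
          sum (λ e → count (spare? e (φ p)))    ≤⟨ ∑-mono-≤ count-spare ⟩
          sum (λ e → ins e * R + inc e)         ≡⟨ ∑-distrib-+ (λ e → ins e * R) inc ⟩
          sum (λ e → ins e * R) + sum inc       ≡⟨ cong (_+ sum inc) (*-distribʳ-sum R ins) ⟨
          sum ins * R + sum inc                 ≡⟨ cong₂ (λ a b → a * R + b) (∑-indicator (inside? T S?))
                                                                             (∑-indicator incident?) ⟩
          count (inside? T S?) * R + count incident? ∎
          where
          open ≤-Reasoning
          ins inc : Fin k → ℕ
          ins = indicator ∘ inside? T S?
          inc = indicator ∘ incident?

    module _ (simple : IsSimple T) (acyclic : Acyclic T)
             {p x e} (Sp : S p) (x∉S : ¬ S x) (e-joins : Joins T e p x)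
             {w j} (u∈j : φ p ∈ H j) (w∈j : w ∈ H j) (w∉φS : ¬ Image S φ w)
             (j-unused : ∀ {e'} → Inside T S e' → f e' ≢ j) where
      private
        φ' : Fin t → Fin n
        φ' = updateAt φ x (const w)

        f' : Fin k → Fin m
        f' = updateAt f e (const j)

        φ'-old : ∀ {y} → S y → φ' y ≡ φ y
        φ'-old {y} Sy = updateAt-minimal y x φ (λ y≡x → x∉S (subst S y≡x Sy))

        φ'-new : φ' x ≡ w
        φ'-new = updateAt-updates x φ

        e∉S : ¬ Inside T S e
        e∉S = joins⇒¬inside T x∉S e-joins

        f'-old : ∀ {e'} → Inside T S e' → f' e' ≡ f e'
        f'-old {e'} e'∈S = updateAt-minimal e' e f (λ e'≡e → e∉S (subst (Inside T S) e'≡e e'∈S))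

        f'-new : f' e ≡ j
        f'-new = updateAt-updates e f

        e∈S' : Inside T (S ∪ ｛ x ｝) e
        e∈S' = [ (λ (e₁≡p , e₂≡x) → inj₁ (subst S (sym e₁≡p) Sp) , inj₂ (sym e₂≡x))
               , (λ (e₁≡x , e₂≡p) → inj₂ (sym e₁≡x) , inj₁ (subst S (sym e₂≡p) Sp)) ]′ e-joins

        entering : ∀ {e'} → Inside T (S ∪ ｛ x ｝) e' → Inside T S e' ⊎ e' ≡ e
        entering = inside-insert⁻ T simple acyclic connectedIn Sp x∉S e-joins

        φ'-old≢w : ∀ {y} → S y → φ' y ≢ w
        φ'-old≢w Sy φ'y≡w = w∉φS (_ , Sy , trans (sym (φ'-old Sy)) φ'y≡w)

        f'-old≢j : ∀ {e'} → Inside T S e' → f' e' ≢ j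
        f'-old≢j e'∈S f'e'≡j = j-unused e'∈S (trans (sym (f'-old e'∈S)) f'e'≡j)

        φ'-inj : ∀ {y z} → (S ∪ ｛ x ｝) y → (S ∪ ｛ x ｝) z → φ' y ≡ φ' z → y ≡ z
        φ'-inj (inj₁ Sy)   (inj₁ Sz)   eq = φ-inj Sy Sz (trans (sym (φ'-old Sy)) (trans eq (φ'-old Sz)))
        φ'-inj (inj₁ Sy)   (inj₂ refl) eq = contradiction (trans eq φ'-new) (φ'-old≢w Sy)
        φ'-inj (inj₂ refl) (inj₁ Sz)   eq = contradiction (trans (sym eq) φ'-new) (φ'-old≢w Sz)
        φ'-inj (inj₂ refl) (inj₂ refl) _  = refl

        f'-inj : ∀ {e₁ e₂} → Inside T (S ∪ ｛ x ｝) e₁ → Inside T (S ∪ ｛ x ｝) e₂ → f' e₁ ≡ f' e₂ → e₁ ≡ e₂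
        f'-inj e₁∈S' e₂∈S' eq with entering e₁∈S' | entering e₂∈S'
        ... | inj₁ e₁∈S | inj₁ e₂∈S = f-inj e₁∈S e₂∈S (trans (sym (f'-old e₁∈S)) (trans eq (f'-old e₂∈S)))
        ... | inj₁ e₁∈S | inj₂ refl = contradiction (trans eq f'-new) (f'-old≢j e₁∈S)
        ... | inj₂ refl | inj₁ e₂∈S = contradiction (trans (sym eq) f'-new) (f'-old≢j e₂∈S)
        ... | inj₂ refl | inj₂ refl = refl

        p∈j : φ' p ∈ H j
        p∈j = subst (_∈ H j) (sym (φ'-old Sp)) u∈j

        x∈j : φ' x ∈ H j
        x∈j = subst (_∈ H j) (sym φ'-new) w∈j

        ends∈j : ∀ {e'} → Joins T e' p x → φ' (end₁ T e') ∈ H j × φ' (end₂ T e') ∈ H j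
        ends∈j (inj₁ (e₁≡p , e₂≡x)) rewrite e₁≡p | e₂≡x = p∈j , x∈j
        ends∈j (inj₂ (e₁≡x , e₂≡p)) rewrite e₁≡x | e₂≡p = x∈j , p∈j

        emb' : ∀ {e'} → Inside T (S ∪ ｛ x ｝) e' → φ' (end₁ T e') ∈ H (f' e') × φ' (end₂ T e') ∈ H (f' e')
        emb' e'∈S' with entering e'∈S'
        ... | inj₁ e'∈S@(S₁ , S₂) rewrite f'-old e'∈S | φ'-old S₁ | φ'-old S₂ = emb e'∈S
        ... | inj₂ refl           rewrite f'-new                           = ends∈j e-joins

        image-bound' : count (image? (S? ∪? (x ≟_)) φ') ≤ count (inside? T (S? ∪? (x ≟_))) + 1
        image-bound' = begin
          count (image? (S? ∪? (x ≟_)) φ')      ≤⟨ count-⊆∪ (image? S? φ) (w ≟_) _ image'⊆ ⟩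
          count (image? S? φ) + count (w ≟_)     ≤⟨ +-mono-≤ image-bound (count≤1 (w ≟_) id) ⟩
          count (inside? T S?) + 1 + 1           ≡⟨ cong (_+ 1) (+-comm _ 1) ⟩
          suc (count (inside? T S?)) + 1         ≤⟨ +-monoˡ-≤ 1 more-inside ⟩
          count (inside? T (S? ∪? (x ≟_))) + 1   ∎
          where
          open ≤-Reasoning
          more-inside : count (inside? T S?) < count (inside? T (S? ∪? (x ≟_)))
          more-inside = count-< (inside? T (S? ∪? (x ≟_))) (inside? T S?) e∈S' e∉S (Product.map inj₁ inj₁)
          image'⊆ : Image (S ∪ ｛ x ｝) φ' ⊆ Image S φ ∪ ｛ w ｝
          image'⊆ (y , inj₁ Sy   , φ'y≡v) = inj₁ (y , Sy , trans (sym (φ'-old Sy)) φ'y≡v)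
          image'⊆ (_ , inj₂ refl , φ'x≡v) = inj₂ (trans (sym φ'-new) φ'x≡v)

      extend : SubtreeCopy (S? ∪? (x ≟_))
      extend = record
        { root        = root
        ; root∈S      = inj₁ root∈S
        ; connectedIn = connected-insert T x∉S connectedIn Sp (e , e-joins)
        ; copy        = record { φ = φ' ; f = f' ; φ-inj = φ'-inj ; f-inj = f'-inj ; emb = emb' }
        ; image-bound = image-bound'
        }

  module _ (simple : IsSimple T) (connected : Connected T) (acyclic : Acyclic T)
           {R Δ} (degree≤Δ : ∀ x → degree T x ≤ Δ) (∣H∣≤ : ∀ j → ∣ H j ∣ ≤ 3 + R)
           (dN≥ : ∀ u → (k + R * (k ∸ 1) + Δ) ∸ 1 ≤ dN H u) where

    module _ {S : Pred (Fin t) 0ℓ} {S? : Decidable S} (sc : SubtreeCopy S?) where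
      open SubtreeCopy sc

      fresh-neighbour : ∀ {p x e} → S p → ¬ S x → Joins T e p x → ∃ (Fresh sc (φ p))
      fresh-neighbour {p} Sp x∉S e-joins with any? (fresh? sc (φ p))
      ... | yes found = found
      ... | no none   = contradiction (dN≥ (φ p)) (<⇒≱ (begin-strict
        dN H (φ p)                           ≤⟨ dN-without-fresh sc Sp none ⟩
        count (image∖u? sc Sp) + spare-total  ≤⟨ +-mono-≤ (count-image∖u sc Sp) (∑-count-spare sc Sp simple ∣H∣≤) ⟩
        I + (I * R + J)                      <⟨ greedy-bound R I<k J<Δ ⟩
        (k + R * (k ∸ 1) + Δ) ∸ 1            ∎))
        where
        open ≤-Reasoning
        spare-total = sum (λ e → count (spare? sc e (φ p)))
        e∉S = joins⇒¬inside T x∉S e-joins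
        I = count (inside? T S?)
        J = count (incident? sc Sp)
        I<k : I < k
        I<k = count<n (inside? T S?) e∉S
        J<Δ : J < Δ
        J<Δ = ≤-trans (count-< (Inc? T p) (incident? sc Sp) (joins⇒inc T e-joins) (e∉S ∘ proj₁) proj₂)
                      (degree≤Δ p)

      step : ∀ {p x e} → S p → ¬ S x → Joins T e p x → SubtreeCopy (S? ∪? (x ≟_))
      step {p} Sp x∉S e-joins with fresh-neighbour Sp x∉S e-joins
      ... | w , (_ , j , u∈j , w∈j) , w∉φS , uncovered =
        extend sc simple acyclic Sp x∉S e-joins u∈j w∈j w∉φS unused
        where
        unused : ∀ {e'} → Inside T S e' → f e' ≢ j
        unused e'∈S refl = uncovered (_ , e'∈S , u∈j , w∈j)

    grow : ∀ {S : Pred (Fin t) 0ℓ} {S? : Decidable S} → SubtreeCopy S? → Acc _<_ (count (∁? S?)) → BergeCopy T H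
    grow {S? = S?} sc (acc smaller) with any? (∁? S?)
    ... | no  none      = complete sc (λ y → decidable-stable (S? y) (λ y∉S → none (y , y∉S)))
    ... | yes (y , y∉S) with crossing-edge T S? (connected (SubtreeCopy.root sc) y) (SubtreeCopy.root∈S sc) y∉S
    ...   | _ , _ , Sp , x∉S , _ , e-joins = grow (step sc Sp x∉S e-joins) (smaller (count-∁-insert S? x∉S))

    -- f is unconstrained off the embedded subtree, but the initial copy still needs some value for it:
    -- a hyperedge exists once T has an edge, as the degree hypothesis then makes d^N positive.
    some-hyperedge : Fin n → Fin k → Fin m
    some-hyperedge u e =
      let _ , _ , j , _ = count>0⇒∃ (Neighbour? H u) (≤-trans (greedy-bound R {0} {0} 0<k 0<Δ) (dN≥ u)) in j
      where
      0<k : 0 < k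
      0<k = ≤-trans (s≤s z≤n) (toℕ<n e)
      0<Δ : 0 < Δ
      0<Δ = ≤-trans (∃⇒count>0 (Inc? T (end₁ T e)) (inj₁ refl)) (degree≤Δ (end₁ T e))

    berge-copy : Fin t → Fin n → BergeCopy T H
    berge-copy r v = grow (initial simple r v (some-hyperedge v)) (<-wellFounded _)

lemma4p2 : (r t k Δ n m : ℕ) → 3 ≤ r →
    (T : Graph t k) → IsTree T → MaxDegree T Δ →
    (H : Hypergraph n m) → IsSimpleHypergraph H → 1 ≤ n →
    (∀ j → 2 ≤ ∣ H j ∣ × ∣ H j ∣ ≤ r) →
    (∀ u → (k + (r ∸ 3) * (k ∸ 1) + Δ) ∸ 1 ≤ dN H u) →
    BergeCopy T H
lemma4p2 (suc (suc (suc R))) t k Δ n m (s≤s (s≤s (s≤s _))) T (1≤t , simple , connected , acyclic) (degree≤Δ , _)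
         H _ 1≤n sizes dN≥ =
  berge-copy T H simple connected acyclic degree≤Δ (proj₂ ∘ sizes) dN≥ (fromℕ< 1≤t) (fromℕ< 1≤n)
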